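{- Let $m\geq 3$ and $G=\Theta(2^m)$. Then $\beta(G)=m$ if $m\leq 4$, and $\beta(G)=m-1$ otherwise.
   Context: Graphs are simple, connected, finite. A set $W\subseteq V(G)$ is resolving if for any distinct $u,v$ there is $w\in W$ with $d(u,w)\ne d(v,w)$; $\beta(G)$ is the minimum size of a resolving set. $\Theta(2^m)$ is the graph consisting of two vertices $c_1,c_2$ joined by $m$ internally disjoint paths of length $3$ (each with two internal vertices). -}

module Defs where

open import Data.Nat using (ℕ; zero; suc; _≤_)
open import Data.Fin using (Fin)
open import Data.List using (List; length)
open import Data.List.Membership.Propositional using (_∈_)
open import Data.List.Relation.Unary.Unique.Propositional using (Unique)
open import Data.Product using (Σ; _×_; ∃; ∃-syntax)
open import Relation.Binary.PropositionalEquality using (_≡_; _≢_)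

record Graph : Set₁ where
  field
    V   : Set
    Adj : V → V → Set
open Graph public

data Walk (G : Graph) : V G → V G → ℕ → Set where
  here : ∀ {u} → Walk G u u zero
  step : ∀ {u v w k} → Adj G u v → Walk G v w k → Walk G u w (suc k)

Dist : (G : Graph) → V G → V G → ℕ → Set
Dist G u v k = Walk G u v k × (∀ j → Walk G u v j → k ≤ j)

Resolving : (G : Graph) → List (V G) → Set
Resolving G W = ∀ u v → u ≢ v →
  ∃[ w ] (w ∈ W × ∃[ k ] ∃[ l ] (Dist G u w k × Dist G v w l × k ≢ l))

MetricDim : (G : Graph) → ℕ → Set
MetricDim G k =
  (∃[ W ] (Unique W × length W ≡ k × Resolving G W)) ×
  (∀ W → Unique W → Resolving G W → k ≤ length W)

-- Θ(2^m): vertices c₁, c₂ and, for each path i, internal vertices a i, b i;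
-- path i is c₁ — a i — b i — c₂.
data ThetaV (m : ℕ) : Set where
  c₁ c₂ : ThetaV m
  a b   : Fin m → ThetaV m

data ThetaEdge (m : ℕ) : ThetaV m → ThetaV m → Set where
  c₁a : ∀ i → ThetaEdge m c₁ (a i)
  ab  : ∀ i → ThetaEdge m (a i) (b i)
  bc₂ : ∀ i → ThetaEdge m (b i) c₂

data ThetaAdj (m : ℕ) (x y : ThetaV m) : Set where
  fwd : ThetaEdge m x y → ThetaAdj m x y
  bwd : ThetaEdge m y x → ThetaAdj m x y

Theta : ℕ → Graph
Theta m = record { V = ThetaV m ; Adj = ThetaAdj m }

-- Θ(2^m) is bipartite, so two vertices on opposite sides are separated by every
-- vertex, and the resolving sets are exactly the sets W that (i) meet at least one of
-- any two paths (the only separators of aᵢ, aⱼ lie on paths i, j), (ii) separate c₁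
-- from each bᵢ, and (iii) separate c₂ from each aᵢ.  By (i) at most one path is
-- missed, so |W| ≥ m - 1; for m ≥ 5 the set {a₁, a₂, b₃, …, b_{m-1}} attains this.
-- If |W| = m - 1 then W consists of exactly one inner vertex on each of m - 1 paths,
-- and (ii), (iii) force two distinct paths through an a-vertex of W and two through a
-- b-vertex, which together with the missed path are five paths; so for m ≤ 4 we get
-- |W| ≥ m, attained by {c₁, a₁, …, a_{m-1}}.
module Submission where

open import Defs
open import Data.Bool using (true; false; if_then_else_)
open import Data.Fin as Fin using (Fin; zero; suc; punchIn)
import Data.Fin.Properties as Finₚ
open import Data.List using (List; []; _∷_; length; map; allFin; lookup)
import Data.List.Properties as Listₚ
open import Data.List.Membership.Propositional using (_∈_; _∉_)
open import Data.List.Membership.Propositional.Properties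
  using (∈-map⁺; ∈-map⁻; ∈-allFin; ∈-lookup)
open import Data.List.Relation.Binary.Subset.Propositional using (_⊆_)
open import Data.List.Relation.Unary.All as All using (All; []; _∷_)
import Data.List.Relation.Unary.All.Properties as Allₚ
open import Data.List.Relation.Unary.AllPairs using ([]; _∷_)
open import Data.List.Relation.Unary.Any as Any using (here; there)
open import Data.List.Relation.Unary.Any.Properties using (lookup-index)
open import Data.List.Relation.Unary.Unique.Propositional using (Unique)
import Data.List.Relation.Unary.Unique.Propositional.Properties as Uniqueₚ
open import Data.Nat as ℕ using (ℕ; suc; _+_; _≤_; _∸_; z≤n; s≤s; parity)
import Data.Nat.Properties as ℕₚ
open import Data.Parity using (Parity; 0ℙ; 1ℙ) renaming (_+_ to _ℙ+_)
import Data.Parity.Properties as Parityₚ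
open import Data.Product as Product using (_×_; _,_; proj₁; proj₂; ∃-syntax)
open import Data.Sum as Sum using (_⊎_; inj₁; inj₂)
open import Function using (_∘_; id; _⇔_; mk⇔; Equivalence)
open import Relation.Binary.Definitions using (DecidableEquality)
open import Relation.Binary.PropositionalEquality
open import Relation.Nullary using (Dec; yes; no; ¬_; does; contradiction; _×-dec_; _⊎-dec_)
open import Relation.Nullary.Decidable as Dec using (True; toWitness; dec-true; dec-false)

open ≡-Reasoning

lookup-injective : ∀ {A : Set} {xs : List A} → Unique xs →
                   ∀ {i j} → lookup xs i ≡ lookup xs j → i ≡ j
lookup-injective (_ ∷ _) {zero} {zero} _ = refl
lookup-injective (x∉xs ∷ _) {zero} {suc j} eq = contradiction eq (All.lookup x∉xs (∈-lookup j))
lookup-injective (x∉xs ∷ _) {suc i} {zero} eq = contradiction (sym eq) (All.lookup x∉xs (∈-lookup i))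
lookup-injective (_ ∷ xs-unique) {suc i} {suc j} eq = cong suc (lookup-injective xs-unique eq)

unique⊆⇒length≤ : ∀ {A : Set} {xs ys : List A} → Unique xs → xs ⊆ ys → length xs ≤ length ys
unique⊆⇒length≤ {xs = xs} {ys} xs-unique xs⊆ys = Finₚ.injective⇒≤ index-injective
  where
  index : Fin (length xs) → Fin (length ys)
  index i = Any.index (xs⊆ys (∈-lookup i))

  index-injective : ∀ {i j} → index i ≡ index j → i ≡ j
  index-injective {i} {j} eq = lookup-injective xs-unique (begin
    lookup xs i          ≡⟨ lookup-index (xs⊆ys (∈-lookup i)) ⟩
    lookup ys (index i)  ≡⟨ cong (lookup ys) eq ⟩
    lookup ys (index j)  ≡⟨ lookup-index (xs⊆ys (∈-lookup j)) ⟨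
    lookup xs j          ∎)

unique⇒length≤ : ∀ {m} {xs : List (Fin m)} → Unique xs → length xs ≤ m
unique⇒length≤ {m} {xs} xs-unique =
  subst (length xs ≤_) (Listₚ.length-tabulate id) (unique⊆⇒length≤ xs-unique (λ {x} _ → ∈-allFin x))

length-map-allFin : ∀ {A : Set} {n} (f : Fin n → A) → length (map f (allFin n)) ≡ n
length-map-allFin {n = n} f = trans (Listₚ.length-map f (allFin n)) (Listₚ.length-tabulate id)

Dist-unique : ∀ {G u v k l} → Dist G u v k → Dist G u v l → k ≡ l
Dist-unique (walkₖ , minₖ) (walkₗ , minₗ) = ℕₚ.≤-antisym (minₖ _ walkₗ) (minₗ _ walkₖ)

private
  decide : ∀ {x y x′ y′} {holds : True ((x ℕ.≤? y) ×-dec (x′ ℕ.≤? y′))} → x ≤ y × x′ ≤ y′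
  decide {holds = holds} = toWitness holds

module _ {m : ℕ} where

  d : ThetaV m → ThetaV m → ℕ
  d c₁ c₁ = 0
  d c₁ c₂ = 3
  d c₁ (a _) = 1
  d c₁ (b _) = 2
  d c₂ c₁ = 3
  d c₂ c₂ = 0
  d c₂ (a _) = 2
  d c₂ (b _) = 1
  d (a _) c₁ = 1
  d (a _) c₂ = 2
  d (a i) (a j) = if does (i Fin.≟ j) then 0 else 2
  d (a i) (b j) = if does (i Fin.≟ j) then 1 else 3
  d (b _) c₁ = 2
  d (b _) c₂ = 1
  d (b i) (a j) = if does (i Fin.≟ j) then 1 else 3
  d (b i) (b j) = if does (i Fin.≟ j) then 0 else 2

  d-self : ∀ u → d u u ≡ 0
  d-self c₁ = refl
  d-self c₂ = refl
  d-self (a i) rewrite dec-true (i Fin.≟ i) refl = refl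
  d-self (b i) rewrite dec-true (i Fin.≟ i) refl = refl

  d-lipschitz : ∀ {x y} → ThetaEdge m x y → ∀ w → d x w ≤ suc (d y w) × d y w ≤ suc (d x w)
  d-lipschitz (c₁a i) c₁ = decide
  d-lipschitz (c₁a i) c₂ = decide
  d-lipschitz (c₁a i) (a j) with does (i Fin.≟ j)
  ... | true = decide
  ... | false = decide
  d-lipschitz (c₁a i) (b j) with does (i Fin.≟ j)
  ... | true = decide
  ... | false = decide
  d-lipschitz (ab i) c₁ = decide
  d-lipschitz (ab i) c₂ = decide
  d-lipschitz (ab i) (a j) with does (i Fin.≟ j)
  ... | true = decide
  ... | false = decide
  d-lipschitz (ab i) (b j) with does (i Fin.≟ j)
  ... | true = decide
  ... | false = decide
  d-lipschitz (bc₂ i) c₁ = decide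
  d-lipschitz (bc₂ i) c₂ = decide
  d-lipschitz (bc₂ i) (a j) with does (i Fin.≟ j)
  ... | true = decide
  ... | false = decide
  d-lipschitz (bc₂ i) (b j) with does (i Fin.≟ j)
  ... | true = decide
  ... | false = decide

  d≤walk-length : ∀ {u v k} → Walk (Theta m) u v k → d u v ≤ k
  d≤walk-length {v = v} here = ℕₚ.≤-reflexive (d-self v)
  d≤walk-length {v = v} (step (fwd e) walk) =
    ℕₚ.≤-trans (proj₁ (d-lipschitz e v)) (s≤s (d≤walk-length walk))
  d≤walk-length {v = v} (step (bwd e) walk) =
    ℕₚ.≤-trans (proj₂ (d-lipschitz e v)) (s≤s (d≤walk-length walk))

  -- A path index is needed only to join c₁ to c₂: Θ(2^0) is disconnected.
  shortest-walk : Fin m → ∀ u v → Walk (Theta m) u v (d u v)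
  shortest-walk _ c₁ c₁ = here
  shortest-walk i c₁ c₂ = step (fwd (c₁a i)) (step (fwd (ab i)) (step (fwd (bc₂ i)) here))
  shortest-walk _ c₁ (a j) = step (fwd (c₁a j)) here
  shortest-walk _ c₁ (b j) = step (fwd (c₁a j)) (step (fwd (ab j)) here)
  shortest-walk i c₂ c₁ = step (bwd (bc₂ i)) (step (bwd (ab i)) (step (bwd (c₁a i)) here))
  shortest-walk _ c₂ c₂ = here
  shortest-walk _ c₂ (a j) = step (bwd (bc₂ j)) (step (bwd (ab j)) here)
  shortest-walk _ c₂ (b j) = step (bwd (bc₂ j)) here
  shortest-walk _ (a j) c₁ = step (bwd (c₁a j)) here
  shortest-walk _ (a j) c₂ = step (fwd (ab j)) (step (fwd (bc₂ j)) here)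
  shortest-walk _ (b j) c₁ = step (bwd (ab j)) (step (bwd (c₁a j)) here)
  shortest-walk _ (b j) c₂ = step (fwd (bc₂ j)) here
  shortest-walk _ (a i) (a j) with i Fin.≟ j
  ... | yes refl = here
  ... | no _ = step (bwd (c₁a i)) (step (fwd (c₁a j)) here)
  shortest-walk _ (a i) (b j) with i Fin.≟ j
  ... | yes refl = step (fwd (ab i)) here
  ... | no _ = step (bwd (c₁a i)) (step (fwd (c₁a j)) (step (fwd (ab j)) here))
  shortest-walk _ (b i) (a j) with i Fin.≟ j
  ... | yes refl = step (bwd (ab i)) here
  ... | no _ = step (fwd (bc₂ i)) (step (bwd (bc₂ j)) (step (bwd (ab j)) here))
  shortest-walk _ (b i) (b j) with i Fin.≟ j
  ... | yes refl = here
  ... | no _ = step (fwd (bc₂ i)) (step (bwd (bc₂ j)) here)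

  d-isDist : Fin m → ∀ u v → Dist (Theta m) u v (d u v)
  d-isDist i u v = shortest-walk i u v , λ _ → d≤walk-length

  Separates : ThetaV m → ThetaV m → ThetaV m → Set
  Separates u v w = d u w ≢ d v w

  Separated : List (ThetaV m) → ThetaV m → ThetaV m → Set
  Separated W u v = ∃[ w ] (w ∈ W × Separates u v w)

  separated-sym : ∀ {W u v} → Separated W u v → Separated W v u
  separated-sym (w , w∈W , separates) = w , w∈W , separates ∘ sym

  resolving⇒separated : Fin m → ∀ {W} → Resolving (Theta m) W →
                        ∀ u v → u ≢ v → Separated W u v
  resolving⇒separated i res u v u≢v with res u v u≢v
  ... | w , w∈W , k , l , distₖ , distₗ , k≢l = w , w∈W , λ eq → k≢l (begin
    k      ≡⟨ Dist-unique distₖ (d-isDist i u w) ⟩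
    d u w  ≡⟨ eq ⟩
    d v w  ≡⟨ Dist-unique (d-isDist i v w) distₗ ⟩
    l      ∎)

  separated⇒resolving : Fin m → ∀ {W} → (∀ u v → u ≢ v → Separated W u v) →
                        Resolving (Theta m) W
  separated⇒resolving i sep u v u≢v with sep u v u≢v
  ... | w , w∈W , separates = w , w∈W , d u w , d v w , d-isDist i u w , d-isDist i v w , separates

  side : ThetaV m → Parity
  side c₁ = 0ℙ
  side (a _) = 1ℙ
  side (b _) = 0ℙ
  side c₂ = 1ℙ

  parity-d : ∀ u w → parity (d u w) ≡ side u ℙ+ side w
  parity-d c₁ c₁ = refl
  parity-d c₁ c₂ = refl
  parity-d c₁ (a _) = refl
  parity-d c₁ (b _) = refl
  parity-d c₂ c₁ = refl
  parity-d c₂ c₂ = refl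
  parity-d c₂ (a _) = refl
  parity-d c₂ (b _) = refl
  parity-d (a _) c₁ = refl
  parity-d (a _) c₂ = refl
  parity-d (a i) (a j) with does (i Fin.≟ j)
  ... | true = refl
  ... | false = refl
  parity-d (a i) (b j) with does (i Fin.≟ j)
  ... | true = refl
  ... | false = refl
  parity-d (b _) c₁ = refl
  parity-d (b _) c₂ = refl
  parity-d (b i) (a j) with does (i Fin.≟ j)
  ... | true = refl
  ... | false = refl
  parity-d (b i) (b j) with does (i Fin.≟ j)
  ... | true = refl
  ... | false = refl

  opposite-sides-separated : ∀ {u v} → side u ≢ side v → ∀ w → Separates u v w
  opposite-sides-separated {u} {v} sides≢ w eq =
    sides≢ (Parityₚ.+-cancelʳ-≡ (side w) (side u) (side v) (begin
      side u ℙ+ side w  ≡⟨ parity-d u w ⟨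
      parity (d u w)    ≡⟨ cong parity eq ⟩
      parity (d v w)    ≡⟨ parity-d v w ⟩
      side v ℙ+ side w  ∎))

  OnPath : ThetaV m → Fin m → Set
  OnPath w i = w ≡ a i ⊎ w ≡ b i

  Meets : List (ThetaV m) → Fin m → Set
  Meets W i = ∃[ w ] (w ∈ W × OnPath w i)

  C₁bSeparator : Fin m → ThetaV m → Set
  C₁bSeparator i w = w ≡ c₁ ⊎ w ≡ c₂ ⊎ w ≡ b i ⊎ ∃[ j ] (j ≢ i × w ≡ a j)

  C₂aSeparator : Fin m → ThetaV m → Set
  C₂aSeparator i w = w ≡ c₁ ⊎ w ≡ c₂ ⊎ w ≡ a i ⊎ ∃[ j ] (j ≢ i × w ≡ b j)

  a-a-separator : ∀ {i j} w → Separates (a i) (a j) w → OnPath w i ⊎ OnPath w j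
  a-a-separator c₁ sep = contradiction refl sep
  a-a-separator c₂ sep = contradiction refl sep
  a-a-separator {i} {j} (a k) sep with i Fin.≟ k | j Fin.≟ k
  ... | yes refl | _ = inj₁ (inj₁ refl)
  ... | no _ | yes refl = inj₂ (inj₁ refl)
  ... | no _ | no _ = contradiction refl sep
  a-a-separator {i} {j} (b k) sep with i Fin.≟ k | j Fin.≟ k
  ... | yes refl | _ = inj₁ (inj₂ refl)
  ... | no _ | yes refl = inj₂ (inj₂ refl)
  ... | no _ | no _ = contradiction refl sep

  own-path-separates : ∀ {i j} → i ≢ j → ∀ w → OnPath w i →
                       Separates (a i) (a j) w × Separates (b i) (b j) w
  own-path-separates {i} {j} i≢j _ (inj₁ refl)
    rewrite dec-true (i Fin.≟ i) refl | dec-false (j Fin.≟ i) (i≢j ∘ sym) = (λ ()) , (λ ())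
  own-path-separates {i} {j} i≢j _ (inj₂ refl)
    rewrite dec-true (i Fin.≟ i) refl | dec-false (j Fin.≟ i) (i≢j ∘ sym) = (λ ()) , (λ ())

  c₁b-separator⇔ : ∀ {i} w → Separates c₁ (b i) w ⇔ C₁bSeparator i w
  c₁b-separator⇔ {i} w = mk⇔ (to w) (from w)
    where
    to : ∀ w → Separates c₁ (b i) w → C₁bSeparator i w
    to c₁ _ = inj₁ refl
    to c₂ _ = inj₂ (inj₁ refl)
    to (a j) sep with i Fin.≟ j
    ... | yes refl = contradiction refl sep
    ... | no i≢j = inj₂ (inj₂ (inj₂ (j , i≢j ∘ sym , refl)))
    to (b j) sep with i Fin.≟ j
    ... | yes refl = inj₂ (inj₂ (inj₁ refl))
    ... | no _ = contradiction refl sep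

    from : ∀ w → C₁bSeparator i w → Separates c₁ (b i) w
    from _ (inj₁ refl) = λ ()
    from _ (inj₂ (inj₁ refl)) = λ ()
    from _ (inj₂ (inj₂ (inj₁ refl))) rewrite dec-true (i Fin.≟ i) refl = λ ()
    from _ (inj₂ (inj₂ (inj₂ (j , j≢i , refl)))) rewrite dec-false (i Fin.≟ j) (j≢i ∘ sym) = λ ()

  c₂a-separator⇔ : ∀ {i} w → Separates c₂ (a i) w ⇔ C₂aSeparator i w
  c₂a-separator⇔ {i} w = mk⇔ (to w) (from w)
    where
    to : ∀ w → Separates c₂ (a i) w → C₂aSeparator i w
    to c₁ _ = inj₁ refl
    to c₂ _ = inj₂ (inj₁ refl)
    to (a j) sep with i Fin.≟ j
    ... | yes refl = inj₂ (inj₂ (inj₁ refl))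
    ... | no _ = contradiction refl sep
    to (b j) sep with i Fin.≟ j
    ... | yes refl = contradiction refl sep
    ... | no i≢j = inj₂ (inj₂ (inj₂ (j , i≢j ∘ sym , refl)))

    from : ∀ w → C₂aSeparator i w → Separates c₂ (a i) w
    from _ (inj₁ refl) = λ ()
    from _ (inj₂ (inj₁ refl)) = λ ()
    from _ (inj₂ (inj₂ (inj₁ refl))) rewrite dec-true (i Fin.≟ i) refl = λ ()
    from _ (inj₂ (inj₂ (inj₂ (j , j≢i , refl)))) rewrite dec-false (i Fin.≟ j) (j≢i ∘ sym) = λ ()

  record ResolvingCriterion (W : List (ThetaV m)) : Set where
    field
      meets-one-of   : ∀ {i j} → i ≢ j → Meets W i ⊎ Meets W j
      separates-c₁-b : ∀ i → ∃[ w ] (w ∈ W × C₁bSeparator i w)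
      separates-c₂-a : ∀ i → ∃[ w ] (w ∈ W × C₂aSeparator i w)
  open ResolvingCriterion public

  separated⇒criterion : ∀ {W} → (∀ u v → u ≢ v → Separated W u v) → ResolvingCriterion W
  separated⇒criterion {W} sep = record
    { meets-one-of = λ {i} {j} i≢j → meets-one (sep (a i) (a j) (i≢j ∘ λ { refl → refl }))
    ; separates-c₁-b = λ i → let w , w∈W , s = sep c₁ (b i) (λ ()) in
        w , w∈W , Equivalence.to (c₁b-separator⇔ w) s
    ; separates-c₂-a = λ i → let w , w∈W , s = sep c₂ (a i) (λ ()) in
        w , w∈W , Equivalence.to (c₂a-separator⇔ w) s
    }
    where
    meets-one : ∀ {i j} → Separated W (a i) (a j) → Meets W i ⊎ Meets W j
    meets-one (w , w∈W , s) = Sum.map (λ p → w , w∈W , p) (λ p → w , w∈W , p) (a-a-separator w s)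

  path-pair-separated : ∀ {W i j} → ResolvingCriterion W → i ≢ j →
                        Separated W (a i) (a j) × Separated W (b i) (b j)
  path-pair-separated crit i≢j with meets-one-of crit i≢j
  ... | inj₁ (w , w∈W , onPath) =
    Product.map (λ s → w , w∈W , s) (λ s → w , w∈W , s) (own-path-separates i≢j w onPath)
  ... | inj₂ (w , w∈W , onPath) =
    Product.map (λ s → w , w∈W , s ∘ sym) (λ s → w , w∈W , s ∘ sym)
      (own-path-separates (i≢j ∘ sym) w onPath)

  same-side-separated : ∀ {W} → ResolvingCriterion W →
                        ∀ u v → side u ≡ side v → u ≢ v → Separated W u v
  same-side-separated _ c₁ c₁ _ u≢v = contradiction refl u≢v
  same-side-separated _ c₂ c₂ _ u≢v = contradiction refl u≢v
  same-side-separated crit c₁ (b i) _ _ =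
    let w , w∈W , shape = separates-c₁-b crit i in w , w∈W , Equivalence.from (c₁b-separator⇔ w) shape
  same-side-separated crit (b i) c₁ sides≡ u≢v =
    separated-sym {u = c₁} {b i} (same-side-separated crit c₁ (b i) (sym sides≡) (u≢v ∘ sym))
  same-side-separated crit c₂ (a i) _ _ =
    let w , w∈W , shape = separates-c₂-a crit i in w , w∈W , Equivalence.from (c₂a-separator⇔ w) shape
  same-side-separated crit (a i) c₂ sides≡ u≢v =
    separated-sym {u = c₂} {a i} (same-side-separated crit c₂ (a i) (sym sides≡) (u≢v ∘ sym))
  same-side-separated crit (a i) (a j) _ u≢v = proj₁ (path-pair-separated crit (u≢v ∘ cong a))
  same-side-separated crit (b i) (b j) _ u≢v = proj₂ (path-pair-separated crit (u≢v ∘ cong b))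
  same-side-separated _ c₁ c₂ () _
  same-side-separated _ c₁ (a _) () _
  same-side-separated _ c₂ c₁ () _
  same-side-separated _ c₂ (b _) () _
  same-side-separated _ (a _) c₁ () _
  same-side-separated _ (a _) (b _) () _
  same-side-separated _ (b _) c₂ () _
  same-side-separated _ (b _) (a _) () _

  criterion⇒separated : ∀ {W} → Fin m → ResolvingCriterion W →
                        ∀ u v → u ≢ v → Separated W u v
  criterion⇒separated i crit u v u≢v with side u Parityₚ.≟ side v
  ... | yes sides≡ = same-side-separated crit u v sides≡ u≢v
  ... | no sides≢ =
    let w , w∈W , _ = separates-c₁-b crit i in w , w∈W , opposite-sides-separated sides≢ w

  _≟_ : DecidableEquality (ThetaV m)
  c₁ ≟ c₁ = yes refl
  c₂ ≟ c₂ = yes refl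
  a i ≟ a j = Dec.map′ (cong a) (λ { refl → refl }) (i Fin.≟ j)
  b i ≟ b j = Dec.map′ (cong b) (λ { refl → refl }) (i Fin.≟ j)
  c₁ ≟ c₂ = no λ ()
  c₁ ≟ a _ = no λ ()
  c₁ ≟ b _ = no λ ()
  c₂ ≟ c₁ = no λ ()
  c₂ ≟ a _ = no λ ()
  c₂ ≟ b _ = no λ ()
  a _ ≟ c₁ = no λ ()
  a _ ≟ c₂ = no λ ()
  a _ ≟ b _ = no λ ()
  b _ ≟ c₁ = no λ ()
  b _ ≟ c₂ = no λ ()
  b _ ≟ a _ = no λ ()

  _∈?_ : ∀ v W → Dec (v ∈ W)
  v ∈? W = Any.any? (v ≟_) W

  meets? : ∀ W i → Dec (Meets W i)
  meets? W i = Dec.map′ from to ((a i ∈? W) ⊎-dec (b i ∈? W))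
    where
    from : a i ∈ W ⊎ b i ∈ W → Meets W i
    from (inj₁ aᵢ∈W) = a i , aᵢ∈W , inj₁ refl
    from (inj₂ bᵢ∈W) = b i , bᵢ∈W , inj₂ refl
    to : Meets W i → a i ∈ W ⊎ b i ∈ W
    to (_ , aᵢ∈W , inj₁ refl) = inj₁ aᵢ∈W
    to (_ , bᵢ∈W , inj₂ refl) = inj₂ bᵢ∈W

  rep : List (ThetaV m) → Fin m → ThetaV m
  rep W j with a j ∈? W
  ... | yes _ = a j
  ... | no _ = b j

  rep∈ : ∀ {W j} → Meets W j → rep W j ∈ W
  rep∈ {W} {j} meets with a j ∈? W
  ... | yes aⱼ∈W = aⱼ∈W
  rep∈ (_ , aⱼ∈W , inj₁ refl) | no aⱼ∉W = contradiction aⱼ∈W aⱼ∉W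
  rep∈ (_ , bⱼ∈W , inj₂ refl) | no _ = bⱼ∈W

  rep-injective : ∀ W {i j} → rep W i ≡ rep W j → i ≡ j
  rep-injective W {i} {j} with a i ∈? W | a j ∈? W
  ... | yes _ | yes _ = λ { refl → refl }
  ... | yes _ | no _ = λ ()
  ... | no _ | yes _ = λ ()
  ... | no _ | no _ = λ { refl → refl }

  rep≢c₁ : ∀ W j → rep W j ≢ c₁
  rep≢c₁ W j with a j ∈? W
  ... | yes _ = λ ()
  ... | no _ = λ ()

  rep≢c₂ : ∀ W j → rep W j ≢ c₂
  rep≢c₂ W j with a j ∈? W
  ... | yes _ = λ ()
  ... | no _ = λ ()

  rep≢b : ∀ {W p} → a p ∈ W → ∀ j → rep W j ≢ b p
  rep≢b {W} aₚ∈W j with a j ∈? W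
  ... | yes _ = λ ()
  ... | no aⱼ∉W = λ { refl → aⱼ∉W aₚ∈W }

module _ {n : ℕ} (W : List (ThetaV (suc n))) (i₀ : Fin (suc n))
         (meets-others : ∀ j → j ≢ i₀ → Meets W j) where

  private
    representatives : List (ThetaV (suc n))
    representatives = map (rep W ∘ punchIn i₀) (allFin n)

    representatives-unique : Unique representatives
    representatives-unique =
      Uniqueₚ.map⁺ (Finₚ.punchIn-injective i₀ _ _ ∘ rep-injective W) (Uniqueₚ.allFin⁺ n)

    representatives⊆W : representatives ⊆ W
    representatives⊆W x∈reps with ∈-map⁻ (rep W ∘ punchIn i₀) x∈reps
    ... | t , _ , refl = rep∈ (meets-others (punchIn i₀ t) (Finₚ.punchInᵢ≢i i₀ t))

    length-representatives : length representatives ≡ n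
    length-representatives = length-map-allFin (rep W ∘ punchIn i₀)

  meets-others⇒≤length : n ≤ length W
  meets-others⇒≤length = subst (_≤ length W) length-representatives
    (unique⊆⇒length≤ representatives-unique representatives⊆W)

  meets-others+extra⇒≤length : ∀ {x} → x ∈ W → (∀ j → j ≢ i₀ → rep W j ≢ x) → suc n ≤ length W
  meets-others+extra⇒≤length {x} x∈W x-new = subst (_≤ length W) (cong suc length-representatives)
    (unique⊆⇒length≤ (x∉reps ∷ representatives-unique) x∷reps⊆W)
    where
    x∉reps : All (x ≢_) representatives
    x∉reps = All.tabulate λ y∈reps → x≢ (∈-map⁻ (rep W ∘ punchIn i₀) y∈reps)
      where
      x≢ : ∀ {y} → ∃[ t ] (t ∈ allFin n × y ≡ rep W (punchIn i₀ t)) → x ≢ y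
      x≢ (t , _ , refl) = x-new (punchIn i₀ t) (Finₚ.punchInᵢ≢i i₀ t) ∘ sym

    x∷reps⊆W : x ∷ representatives ⊆ W
    x∷reps⊆W (here refl) = x∈W
    x∷reps⊆W (there y∈reps) = representatives⊆W y∈reps

meets-all⇒≤length : ∀ {n} {W : List (ThetaV (suc n))} → (∀ j → Meets W j) → suc n ≤ length W
meets-all⇒≤length {W = W} meets =
  meets-others+extra⇒≤length W zero (λ j _ → meets j) (rep∈ (meets zero))
    (λ j j≢0 → j≢0 ∘ rep-injective W)

module _ {m : ℕ} {W : List (ThetaV m)} (crit : ResolvingCriterion W) where

  all-met-or-one-missed :
    (∀ j → Meets W j) ⊎ ∃[ i₀ ] (¬ Meets W i₀ × (∀ j → j ≢ i₀ → Meets W j))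
  all-met-or-one-missed with Finₚ.all? (meets? W)
  ... | yes all = inj₁ all
  ... | no ¬all with Finₚ.¬∀⟶∃¬ m (Meets W) (meets? W) ¬all
  ... | i₀ , missed = inj₂ (i₀ , missed , λ j j≢i₀ →
    Sum.[ id , (λ met → contradiction met missed) ]′ (meets-one-of crit j≢i₀))

  module _ (c₁∉W : c₁ ∉ W) (c₂∉W : c₂ ∉ W) where

    a-on-another-path : ∀ i → b i ∉ W → ∃[ j ] (j ≢ i × a j ∈ W)
    a-on-another-path i bᵢ∉W with separates-c₁-b crit i
    ... | _ , c₁∈W , inj₁ refl = contradiction c₁∈W c₁∉W
    ... | _ , c₂∈W , inj₂ (inj₁ refl) = contradiction c₂∈W c₂∉W
    ... | _ , bᵢ∈W , inj₂ (inj₂ (inj₁ refl)) = contradiction bᵢ∈W bᵢ∉W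
    ... | _ , aⱼ∈W , inj₂ (inj₂ (inj₂ (j , j≢i , refl))) = j , j≢i , aⱼ∈W

    b-on-another-path : ∀ i → a i ∉ W → ∃[ j ] (j ≢ i × b j ∈ W)
    b-on-another-path i aᵢ∉W with separates-c₂-a crit i
    ... | _ , c₁∈W , inj₁ refl = contradiction c₁∈W c₁∉W
    ... | _ , c₂∈W , inj₂ (inj₁ refl) = contradiction c₂∈W c₂∉W
    ... | _ , aᵢ∈W , inj₂ (inj₂ (inj₁ refl)) = contradiction aᵢ∈W aᵢ∉W
    ... | _ , bⱼ∈W , inj₂ (inj₂ (inj₂ (j , j≢i , refl))) = j , j≢i , bⱼ∈W

    five-paths : ∀ {i₀} → ¬ Meets W i₀ → (∀ p → a p ∈ W → b p ∉ W) → 5 ≤ m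
    five-paths {i₀} missed single =
      let k , k≢i₀ , aₖ∈W = a-on-another-path i₀ λ bᵢ₀∈W → missed (b i₀ , bᵢ₀∈W , inj₂ refl)
          j , j≢k , aⱼ∈W = a-on-another-path k (single k aₖ∈W)
          l , l≢i₀ , bₗ∈W = b-on-another-path i₀ λ aᵢ₀∈W → missed (a i₀ , aᵢ₀∈W , inj₁ refl)
          l′ , l′≢l , bₗ′∈W = b-on-another-path l λ aₗ∈W → single l aₗ∈W bₗ∈W
      in unique⇒length≤ {xs = i₀ ∷ k ∷ j ∷ l ∷ l′ ∷ []}
           ((k≢i₀ ∘ sym ∷ a-path≢i₀ aⱼ∈W ∷ l≢i₀ ∘ sym ∷ b-path≢i₀ bₗ′∈W ∷ []) ∷
            (j≢k ∘ sym ∷ a≢b aₖ∈W bₗ∈W ∷ a≢b aₖ∈W bₗ′∈W ∷ []) ∷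
            (a≢b aⱼ∈W bₗ∈W ∷ a≢b aⱼ∈W bₗ′∈W ∷ []) ∷
            (l′≢l ∘ sym ∷ []) ∷
            [] ∷ [])
      where
      a-path≢i₀ : ∀ {x} → a x ∈ W → i₀ ≢ x
      a-path≢i₀ aₓ∈W refl = missed (_ , aₓ∈W , inj₁ refl)
      b-path≢i₀ : ∀ {x} → b x ∈ W → i₀ ≢ x
      b-path≢i₀ bₓ∈W refl = missed (_ , bₓ∈W , inj₂ refl)
      a≢b : ∀ {x y} → a x ∈ W → b y ∈ W → x ≢ y
      a≢b aₓ∈W bₓ∈W refl = single _ aₓ∈W bₓ∈W

lower-bound : ∀ {n} {W : List (ThetaV (suc n))} → ResolvingCriterion W → n ≤ length W
lower-bound {W = W} crit with all-met-or-one-missed crit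
... | inj₁ all = meets-others⇒≤length W zero (λ j _ → all j)
... | inj₂ (i₀ , _ , others) = meets-others⇒≤length W i₀ others

lower-bound-≤4 : ∀ {n} {W : List (ThetaV (suc n))} → suc n ≤ 4 → ResolvingCriterion W →
                 suc n ≤ length W
lower-bound-≤4 {W = W} m≤4 crit with all-met-or-one-missed crit
... | inj₁ all = meets-all⇒≤length all
... | inj₂ (i₀ , missed , others)
  with c₁ ∈? W | c₂ ∈? W | Finₚ.any? (λ p → (a p ∈? W) ×-dec (b p ∈? W))
... | yes c₁∈W | _ | _ = meets-others+extra⇒≤length W i₀ others c₁∈W (λ j _ → rep≢c₁ W j)
... | no _ | yes c₂∈W | _ = meets-others+extra⇒≤length W i₀ others c₂∈W (λ j _ → rep≢c₂ W j)
... | no _ | no _ | yes (p , aₚ∈W , bₚ∈W) =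
  meets-others+extra⇒≤length W i₀ others bₚ∈W (λ j _ → rep≢b aₚ∈W j)
... | no c₁∉W | no c₂∉W | no no-double =
  contradiction (five-paths crit c₁∉W c₂∉W missed λ p aₚ∈W bₚ∈W → no-double (p , aₚ∈W , bₚ∈W))
    (ℕₚ.≤⇒≯ m≤4)

resolving⇔criterion : ∀ {m} {W : List (ThetaV m)} → Fin m →
                      Resolving (Theta m) W ⇔ ResolvingCriterion W
resolving⇔criterion i = mk⇔ (separated⇒criterion ∘ resolving⇒separated i)
                            (separated⇒resolving i ∘ criterion⇒separated i)

meets-suc⇒meets-one-of : ∀ {n} {W : List (ThetaV (suc n))} → (∀ k → Meets W (suc k)) →
                         ∀ {i j} → i ≢ j → Meets W i ⊎ Meets W j
meets-suc⇒meets-one-of _ {zero} {zero} 0≢0 = contradiction refl 0≢0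
meets-suc⇒meets-one-of meets {zero} {suc k} _ = inj₂ (meets k)
meets-suc⇒meets-one-of meets {suc k} _ = inj₁ (meets k)

basisWithC₁ : ∀ n → List (ThetaV (suc n))
basisWithC₁ n = c₁ ∷ map (a ∘ suc) (allFin n)

basisWithC₁-unique : ∀ n → Unique (basisWithC₁ n)
basisWithC₁-unique n =
  Allₚ.map⁺ (All.universal (λ _ ()) (allFin n)) ∷ Uniqueₚ.map⁺ (λ { refl → refl }) (Uniqueₚ.allFin⁺ n)

basisWithC₁-criterion : ∀ n → ResolvingCriterion (basisWithC₁ n)
basisWithC₁-criterion n = record
  { meets-one-of = meets-suc⇒meets-one-of λ k →
      a (suc k) , there (∈-map⁺ (a ∘ suc) (∈-allFin k)) , inj₁ refl
  ; separates-c₁-b = λ _ → c₁ , here refl , inj₁ refl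
  ; separates-c₂-a = λ _ → c₁ , here refl , inj₁ refl
  }

basisWithoutCentre : ∀ n → List (ThetaV (5 + n))
basisWithoutCentre n = a (suc zero) ∷ a (suc (suc zero)) ∷ map (b ∘ (3 Fin.↑ʳ_)) (allFin (2 + n))

basisWithoutCentre-unique : ∀ n → Unique (basisWithoutCentre n)
basisWithoutCentre-unique n =
  ((λ ()) ∷ Allₚ.map⁺ (All.universal (λ _ ()) _)) ∷
  Allₚ.map⁺ (All.universal (λ _ ()) _) ∷
  Uniqueₚ.map⁺ (λ { refl → refl }) (Uniqueₚ.allFin⁺ (2 + n))

basisWithoutCentre-criterion : ∀ n → ResolvingCriterion (basisWithoutCentre n)
basisWithoutCentre-criterion n = record
  { meets-one-of = meets-suc⇒meets-one-of meets
  ; separates-c₁-b = separates-c₁-b′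
  ; separates-c₂-a = separates-c₂-a′
  }
  where
  W = basisWithoutCentre n

  b∈W : ∀ k → b (3 Fin.↑ʳ k) ∈ W
  b∈W k = there (there (∈-map⁺ (b ∘ (3 Fin.↑ʳ_)) (∈-allFin k)))

  meets : ∀ k → Meets W (suc k)
  meets zero = a (suc zero) , here refl , inj₁ refl
  meets (suc zero) = a (suc (suc zero)) , there (here refl) , inj₁ refl
  meets (suc (suc k)) = b (suc (suc (suc k))) , b∈W k , inj₂ refl

  separates-c₁-b′ : ∀ i → ∃[ w ] (w ∈ W × C₁bSeparator i w)
  separates-c₁-b′ (suc zero) =
    a (suc (suc zero)) , there (here refl) , inj₂ (inj₂ (inj₂ (suc (suc zero) , (λ ()) , refl)))
  separates-c₁-b′ zero = a (suc zero) , here refl , inj₂ (inj₂ (inj₂ (suc zero , (λ ()) , refl)))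
  separates-c₁-b′ (suc (suc _)) =
    a (suc zero) , here refl , inj₂ (inj₂ (inj₂ (suc zero , (λ ()) , refl)))

  b₃ b₄ : ThetaV (5 + n)
  b₃ = b (3 Fin.↑ʳ zero)
  b₄ = b (3 Fin.↑ʳ suc zero)

  separates-c₂-a′ : ∀ i → ∃[ w ] (w ∈ W × C₂aSeparator i w)
  separates-c₂-a′ i@(suc (suc (suc zero))) =
    b₄ , b∈W (suc zero) , inj₂ (inj₂ (inj₂ (_ , (λ ()) , refl)))
  separates-c₂-a′ zero = b₃ , b∈W zero , inj₂ (inj₂ (inj₂ (_ , (λ ()) , refl)))
  separates-c₂-a′ (suc zero) = b₃ , b∈W zero , inj₂ (inj₂ (inj₂ (_ , (λ ()) , refl)))
  separates-c₂-a′ (suc (suc zero)) = b₃ , b∈W zero , inj₂ (inj₂ (inj₂ (_ , (λ ()) , refl)))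
  separates-c₂-a′ (suc (suc (suc (suc _)))) = b₃ , b∈W zero , inj₂ (inj₂ (inj₂ (_ , (λ ()) , refl)))

metricDim-≤4 : ∀ {n} → suc n ≤ 4 → MetricDim (Theta (suc n)) (suc n)
metricDim-≤4 {n} m≤4 =
  ( basisWithC₁ n , basisWithC₁-unique n , cong suc (length-map-allFin (a ∘ suc))
  , Equivalence.from (resolving⇔criterion zero) (basisWithC₁-criterion n) )
  , λ _ _ res → lower-bound-≤4 m≤4 (Equivalence.to (resolving⇔criterion zero) res)

metricDim-≥5 : ∀ {m} → 5 ≤ m → MetricDim (Theta m) (m ∸ 1)
metricDim-≥5 (s≤s (s≤s (s≤s (s≤s (s≤s (z≤n {n})))))) =
  ( basisWithoutCentre n , basisWithoutCentre-unique n
  , cong (2 +_) (length-map-allFin (b ∘ (3 Fin.↑ʳ_)))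
  , Equivalence.from (resolving⇔criterion zero) (basisWithoutCentre-criterion n) )
  , λ _ _ res → lower-bound (Equivalence.to (resolving⇔criterion zero) res)

mainTheorem17 : (m : ℕ) → 3 ≤ m →
    (m ≤ 4 → MetricDim (Theta m) m) × (5 ≤ m → MetricDim (Theta m) (m ∸ 1))
mainTheorem17 (suc _) _ = metricDim-≤4 , metricDim-≥5
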